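{- Let $R_w$ be the $5$-ary Boolean relation $R_w(x_1,x_2,x_3,x_4,c_0)\equiv(x_1\leftrightarrow x_2\wedge x_3)\wedge(x_2\vee x_3\to x_4)\wedge(c_0=0)$. Then $\langle R_w\rangle_{\exists!}\subsetneq\mathrm{IE}_0$.
   Context: $\mathrm{IE}_0=\mathrm{Inv}(\{\wedge,0\})$ is the set of Boolean relations preserved (under coordinatewise application) by binary conjunction $\wedge$ and by the constant operation $0$; it equals $\langle R_w\rangle$. A upp-definition of an $n$-ary relation $R$ over $\Gamma$ is a formula $R(x_1,\dots,x_n)\equiv\exists y_1,\dots,y_m\colon R_1(\mathbf{x}_1)\wedge\dots\wedge R_k(\mathbf{x}_k)$ with each $R_j\in\Gamma\cup\{\mathrm{Eq}\}$ (equality relation), $\mathbf{x}_j$ tuples of variables among $x_1,\dots,x_n,y_1,\dots,y_m$, such that each $y_j$ is uniquely determined by $x_1,\dots,x_n$ (a function of their values in every satisfying assignment of the conjunction). $\langle\Gamma\rangle_{\exists!}$ is the set of relations upp-definable over $\Gamma$. -}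

module Defs where

open import Data.Bool using (Bool; true; false; _∧_; _∨_)
open import Data.Nat using (ℕ; _+_)
open import Data.Fin using (Fin; zero; suc)
open import Data.List using (List; []; _∷_; length; lookup)
open import Data.List.Relation.Unary.All using (All)
open import Data.Product using (Σ; ∃; _×_; _,_; proj₁; proj₂)
open import Data.Vec.Functional using (Vector; _++_)
open import Relation.Binary.PropositionalEquality using (_≡_)
open import Level using (0ℓ) renaming (suc to lsuc)

BRel : ℕ → Set₁
BRel n = (Fin n → Bool) → Set

_⊆ᴿ_ : ∀ {n} → BRel n → BRel n → Set
R ⊆ᴿ S = ∀ t → R t → S t

_≐ᴿ_ : ∀ {n} → BRel n → BRel n → Set
R ≐ᴿ S = (R ⊆ᴿ S) × (S ⊆ᴿ R)

Lang : Set₁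
Lang = List (Σ ℕ BRel)

arity : (Γ : Lang) → Fin (length Γ) → ℕ
arity Γ i = proj₁ (lookup Γ i)

relOf : (Γ : Lang) → (i : Fin (length Γ)) → BRel (arity Γ i)
relOf Γ i = proj₂ (lookup Γ i)

data Atom (Γ : Lang) (v : ℕ) : Set where
  rel : (i : Fin (length Γ)) → (Fin (arity Γ i) → Fin v) → Atom Γ v
  eq  : Fin v → Fin v → Atom Γ v

SatAtom : ∀ {Γ v} → (Fin v → Bool) → Atom Γ v → Set
SatAtom {Γ} s (rel i σ) = relOf Γ i (λ j → s (σ j))
SatAtom     s (eq a b)  = s a ≡ s b

Sat : ∀ {Γ v} → (Fin v → Bool) → List (Atom Γ v) → Set
Sat s φ = All (SatAtom s) φ

-- Unique-primitive-positive definition of an n-ary relation R over Γ: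
-- R(x) ≡ ∃ y_1..y_m . φ(x,y) where each y is uniquely determined by x.
-- Variables 0..n-1 are x_1..x_n, variables n..n+m-1 are y_1..y_m.
UppDefinable : (Γ : Lang) → ∀ {n} → BRel n → Set
UppDefinable Γ {n} R =
  Σ ℕ λ m → Σ (List (Atom Γ (n + m))) λ φ →
    (∀ (x : Fin n → Bool) → (R x → ∃ λ (y : Fin m → Bool) → Sat (x ++ y) φ)
                          × ((∃ λ (y : Fin m → Bool) → Sat (x ++ y) φ) → R x))
    × (∀ (x : Fin n → Bool) (y y′ : Fin m → Bool) →
         Sat (x ++ y) φ → Sat (x ++ y′) φ → ∀ j → y j ≡ y′ j)

PreservedBy∧ : ∀ {n} → BRel n → Set
PreservedBy∧ R = ∀ a b → R a → R b → R (λ i → a i ∧ b i)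

PreservedBy0 : ∀ {n} → BRel n → Set
PreservedBy0 R = R (λ _ → false)

InIE₀ : ∀ {n} → BRel n → Set
InIE₀ R = PreservedBy∧ R × PreservedBy0 R

Rw : BRel 5
Rw t = (t zero ≡ (t (suc zero) ∧ t (suc (suc zero))))
     × ((t (suc zero) ∨ t (suc (suc zero))) ≡ true → t (suc (suc (suc zero))) ≡ true)
     × (t (suc (suc (suc (suc zero)))) ≡ false)

Γw : Lang
Γw = (5 , Rw) ∷ []

-- Relations upp-definable over Γ inherit the polymorphisms of Γ: combine the
-- witnessing assignments coordinatewise. Besides ∧ and 0, R_w is preserved by ∨
-- on disjoint tuples (x₂ ∧ x₃′ = 1 would force x₄ = x₄′ = 1). Uniqueness of the
-- witnesses lifts this partial polymorphism to ⟨R_w⟩_∃!: witnesses y, y′ for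
-- disjoint tuples a, b are disjoint, since y ∧ y′ and 0 both witness a ∧ b = 0.
-- The relation x₁ ∧ x₂ = 0 lies in IE₀ but is not preserved by disjoint ∨.
module Submission where

open import Defs
open import Data.Nat using (ℕ)
open import Data.Product using (Σ; _×_)
open import Relation.Nullary using (¬_)

open import Algebra.Bundles using (CommutativeMonoid)
import Algebra.Properties.CommutativeSemigroup as CommutativeSemigroupProperties
open import Data.Bool using (Bool; true; false; _∧_; _∨_)
open import Data.Bool.Properties
  using (∧-commutativeMonoid; ∨-commutativeMonoid; ∧-conicalˡ; ∧-conicalʳ; ∧-comm; ∧-zeroʳ; ∨-zeroʳ)
open import Data.Fin using (Fin; zero; suc; #_; splitAt)
open import Data.List using (List)
open import Data.List.Relation.Unary.All as All using ()
open import Data.Nat using (_+_)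
open import Data.Product using (_,_; proj₁; proj₂)
open import Data.Sum using (inj₁; inj₂)
open import Data.Unit using (⊤)
open import Data.Vec.Functional using (Vector; _++_; zipWith; replicate; []; _∷_)
open import Function using (_∘_)
open import Relation.Binary.Definitions using (_Respects_)
open import Relation.Binary.PropositionalEquality using (_≡_; _≗_; refl; sym; trans; cong; cong₂)

open CommutativeSemigroupProperties (CommutativeMonoid.commutativeSemigroup ∧-commutativeMonoid)
  using () renaming (interchange to ∧-interchange)
open CommutativeSemigroupProperties (CommutativeMonoid.commutativeSemigroup ∨-commutativeMonoid)
  using () renaming (interchange to ∨-interchange)

PreservedOn : ∀ {n} → (Bool → Bool → Set) → (Bool → Bool → Bool) → BRel n → Set
PreservedOn C f R = ∀ a b → (∀ i → C (a i) (b i)) → R a → R b → R (zipWith f a b)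

PreservedBy : ∀ {n} → (Bool → Bool → Bool) → BRel n → Set
PreservedBy f R = ∀ a b → R a → R b → R (zipWith f a b)

Disjointᵇ : Bool → Bool → Set
Disjointᵇ x y = x ∧ y ≡ false

Disjoint : ∀ {n} → Vector Bool n → Vector Bool n → Set
Disjoint a b = zipWith _∧_ a b ≗ replicate _ false

PreservedByDisjoint∨ : ∀ {n} → BRel n → Set
PreservedByDisjoint∨ = PreservedOn Disjointᵇ _∨_

zipWith-++ : ∀ {m n} (f : Bool → Bool → Bool) (xs xs′ : Vector Bool m) (ys ys′ : Vector Bool n) →
             zipWith f (xs ++ ys) (xs′ ++ ys′) ≗ zipWith f xs xs′ ++ zipWith f ys ys′
zipWith-++ {m} f xs xs′ ys ys′ k with splitAt m k
... | inj₁ i = refl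
... | inj₂ j = refl

++-replicate : ∀ {m n} {x : Bool} {xs : Vector Bool m} {ys : Vector Bool n} →
               xs ≗ replicate m x → ys ≗ replicate n x → xs ++ ys ≗ replicate (m + n) x
++-replicate {m} e e′ k with splitAt m k
... | inj₁ i = e i
... | inj₂ j = e′ j

Disjoint-++ : ∀ {m n} {a b : Vector Bool m} {y y′ : Vector Bool n} →
              Disjoint a b → Disjoint y y′ → Disjoint (a ++ y) (b ++ y′)
Disjoint-++ {a = a} {b} {y} {y′} a#b y#y′ k =
  trans (zipWith-++ _∧_ a b y y′ k) (++-replicate a#b y#y′ k)

∧-mono-⇒ : ∀ {x x′ y y′} → (x ≡ true → y ≡ true) → (x′ ≡ true → y′ ≡ true) →
           x ∧ x′ ≡ true → y ∧ y′ ≡ true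
∧-mono-⇒ h h′ e = cong₂ _∧_ (h (∧-conicalˡ _ _ e)) (h′ (∧-conicalʳ _ _ e))

∨-mono-⇒ : ∀ {x x′ y y′} → (x ≡ true → y ≡ true) → (x′ ≡ true → y′ ≡ true) →
           x ∨ x′ ≡ true → y ∨ y′ ≡ true
∨-mono-⇒ {true}          h _  _ = cong (_∨ _) (h refl)
∨-mono-⇒ {false} {y = y} _ h′ e = trans (cong (y ∨_) (h′ e)) (∨-zeroʳ y)

∨-∧-⇒-∧-∨ : ∀ b c b′ c′ → (b ∧ b′) ∨ (c ∧ c′) ≡ true → (b ∨ c) ∧ (b′ ∨ c′) ≡ true
∨-∧-⇒-∧-∨ true  true  _    _  e  = e
∨-∧-⇒-∧-∨ true  false true _  _  = refl
∨-∧-⇒-∧-∨ true  false false _ ()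
∨-∧-⇒-∧-∨ false true  b′   _  e  = trans (cong (b′ ∨_) e) (∨-zeroʳ b′)
∨-∧-⇒-∧-∨ false false _    _  ()

∨-∧-disjoint : ∀ b c b′ c′ → b ∧ c′ ≡ false → b′ ∧ c ≡ false →
               (b ∧ c) ∨ (b′ ∧ c′) ≡ (b ∨ b′) ∧ (c ∨ c′)
∨-∧-disjoint true  true  _     _ _    _  = refl
∨-∧-disjoint true  false b′    _ refl _  = ∧-zeroʳ b′
∨-∧-disjoint false true  false _ _    _  = refl
∨-∧-disjoint false true  true  _ _    ()
∨-∧-disjoint false false _     _ _    _  = refl

∧-false-of-⇒ : ∀ b c b′ c′ {d d′} → (b ∨ c ≡ true → d ≡ true) → (b′ ∨ c′ ≡ true → d′ ≡ true) →
               d ∧ d′ ≡ false → b ∧ c′ ≡ false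
∧-false-of-⇒ false _ _  _     _ _  _  = refl
∧-false-of-⇒ true  _ _  false _ _  _  = refl
∧-false-of-⇒ true  _ b′ true  h h′ dd rewrite h refl | h′ (∨-zeroʳ b′) = dd

module _ {Γ : Lang} {v : ℕ} where

  SatAtom-resp : (∀ i → relOf Γ i Respects _≗_) → {s s′ : Fin v → Bool} → s ≗ s′ →
                 ∀ {α} → SatAtom s α → SatAtom {Γ} s′ α
  SatAtom-resp resp e {rel i σ} p = resp i (e ∘ σ) p
  SatAtom-resp resp e {eq a b}  p = trans (sym (e a)) (trans p (e b))

  SatAtom-zipWith : ∀ {C f} → (∀ i → PreservedOn C f (relOf Γ i)) →
                    {s s′ : Fin v → Bool} → (∀ k → C (s k) (s′ k)) →
                    ∀ {α} → SatAtom s α × SatAtom s′ α → SatAtom {Γ} (zipWith f s s′) α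
  SatAtom-zipWith pres c {rel i σ} (p , p′) = pres i _ _ (c ∘ σ) p p′
  SatAtom-zipWith {f = f} pres c {eq a b} (p , p′) = cong₂ f p p′

  SatAtom-false : (∀ i → PreservedBy0 (relOf Γ i)) → ∀ α → SatAtom {Γ} {v} (λ _ → false) α
  SatAtom-false zeros (rel i σ) = zeros i
  SatAtom-false zeros (eq a b)  = refl

module UppClosure (Γ : Lang) (resp : ∀ i → relOf Γ i Respects _≗_) where

  Sat-resp : ∀ {v} {s s′ : Fin v → Bool} {φ : List (Atom Γ v)} → s ≗ s′ → Sat s φ → Sat s′ φ
  Sat-resp e = All.map (λ {α} → SatAtom-resp resp e {α})

  Sat-zipWith-++ : ∀ {n m C f} {φ : List (Atom Γ (n + m))} → (∀ i → PreservedOn C f (relOf Γ i)) →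
                   {a b : Vector Bool n} {y y′ : Vector Bool m} →
                   (∀ k → C ((a ++ y) k) ((b ++ y′) k)) →
                   Sat (a ++ y) φ → Sat (b ++ y′) φ → Sat (zipWith f a b ++ zipWith f y y′) φ
  Sat-zipWith-++ {C = C} {f} pres {a} {b} {y} {y′} c sy sy′ =
    Sat-resp (zipWith-++ f a b y y′)
             (All.zipWith (λ {α} → SatAtom-zipWith {C = C} {f = f} pres c {α}) (sy , sy′))

  uppDefinable-preservedBy : ∀ f → (∀ i → PreservedBy f (relOf Γ i)) →
                             ∀ {n} {R : BRel n} → UppDefinable Γ R → PreservedBy f R
  uppDefinable-preservedBy f pres {n} (m , φ , defn , _) a b Ra Rb
    with proj₁ (defn a) Ra | proj₁ (defn b) Rb
  ... | y , sy | y′ , sy′ =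
    proj₂ (defn (zipWith f a b))
          (zipWith f y y′ , Sat-zipWith-++ {n} {m} {λ _ _ → ⊤} {f} (λ i a b _ → pres i a b) _ sy sy′)

  uppDefinable-preservedBy0 : (∀ i → PreservedBy0 (relOf Γ i)) →
                              ∀ {n} {R : BRel n} → UppDefinable Γ R → PreservedBy0 R
  uppDefinable-preservedBy0 zeros {n} (m , φ , defn , _) =
    proj₂ (defn _) (_ , Sat-resp (sym ∘ ++-replicate {n} {m} (λ _ → refl) (λ _ → refl))
                                 (All.universal (SatAtom-false zeros) φ))

  uppDefinable-preservedByDisjoint∨ :
    (∀ i → PreservedBy _∧_ (relOf Γ i)) → (∀ i → PreservedBy0 (relOf Γ i)) →
    (∀ i → PreservedByDisjoint∨ (relOf Γ i)) →
    ∀ {n} {R : BRel n} → UppDefinable Γ R → PreservedByDisjoint∨ R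
  uppDefinable-preservedByDisjoint∨ ands zeros ors {n} (m , φ , defn , unique) a b a#b Ra Rb
    with proj₁ (defn a) Ra | proj₁ (defn b) Rb
  ... | y , sy | y′ , sy′ =
    proj₂ (defn (zipWith _∨_ a b))
          (zipWith _∨_ y y′ , Sat-zipWith-++ {n} {m} {Disjointᵇ} {_∨_} ors (Disjoint-++ a#b y#y′) sy sy′)
    where
    y#y′ : Disjoint y y′
    y#y′ = unique (zipWith _∧_ a b) (zipWith _∧_ y y′) (replicate m false)
      (Sat-zipWith-++ {n} {m} {λ _ _ → ⊤} {_∧_} (λ i a b _ → ands i a b) _ sy sy′)
      (Sat-resp (sym ∘ ++-replicate a#b (λ _ → refl)) (All.universal (SatAtom-false zeros) φ))

Rw-resp : Rw Respects _≗_
Rw-resp e (p , q , r) =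
    trans (sym (e (# 0))) (trans p (cong₂ _∧_ (e (# 1)) (e (# 2))))
  , (λ h → trans (sym (e (# 3))) (q (trans (cong₂ _∨_ (e (# 1)) (e (# 2))) h)))
  , trans (sym (e (# 4))) r

Rw-false : PreservedBy0 Rw
Rw-false = refl , (λ ()) , refl

Rw-∧ : PreservedBy _∧_ Rw
Rw-∧ s t (p , q , r) (p′ , q′ , r′) =
    trans (cong₂ _∧_ p p′) (∧-interchange s₁ s₂ t₁ t₂)
  , ∧-mono-⇒ q q′ ∘ ∨-∧-⇒-∧-∨ s₁ s₂ t₁ t₂
  , cong₂ _∧_ r r′
  where
  s₁ s₂ t₁ t₂ : Bool
  s₁ = s (# 1)
  s₂ = s (# 2)
  t₁ = t (# 1)
  t₂ = t (# 2)

Rw-disjoint-∨ : PreservedByDisjoint∨ Rw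
Rw-disjoint-∨ s t s#t (p , q , r) (p′ , q′ , r′) =
    trans (cong₂ _∨_ p p′) (∨-∧-disjoint s₁ s₂ t₁ t₂ s₁#t₂ t₁#s₂)
  , ∨-mono-⇒ q q′ ∘ trans (∨-interchange s₁ s₂ t₁ t₂)
  , cong₂ _∨_ r r′
  where
  s₁ s₂ t₁ t₂ : Bool
  s₁ = s (# 1)
  s₂ = s (# 2)
  t₁ = t (# 1)
  t₂ = t (# 2)
  s₁#t₂ : s₁ ∧ t₂ ≡ false
  s₁#t₂ = ∧-false-of-⇒ s₁ s₂ t₁ t₂ q q′ (s#t (# 3))
  t₁#s₂ : t₁ ∧ s₂ ≡ false
  t₁#s₂ = ∧-false-of-⇒ t₁ t₂ s₁ s₂ q′ q (trans (∧-comm (t (# 3)) (s (# 3))) (s#t (# 3)))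

Γw-resp : ∀ i → relOf Γw i Respects _≗_
Γw-resp zero = Rw-resp

Γw-∧ : ∀ i → PreservedBy _∧_ (relOf Γw i)
Γw-∧ zero = Rw-∧

Γw-false : ∀ i → PreservedBy0 (relOf Γw i)
Γw-false zero = Rw-false

Γw-disjoint-∨ : ∀ i → PreservedByDisjoint∨ (relOf Γw i)
Γw-disjoint-∨ zero = Rw-disjoint-∨


open UppClosure Γw Γw-resp

uppDefinable-InIE₀ : ∀ {n} {R : BRel n} → UppDefinable Γw R → InIE₀ R
uppDefinable-InIE₀ R-def =
  uppDefinable-preservedBy _∧_ Γw-∧ R-def , uppDefinable-preservedBy0 Γw-false R-def

Nand : BRel 2
Nand x = x (# 0) ∧ x (# 1) ≡ false

Nand-∧ : PreservedBy _∧_ Nand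
Nand-∧ s t p q = trans (∧-interchange (s (# 0)) (t (# 0)) (s (# 1)) (t (# 1))) (cong₂ _∧_ p q)

Nand-not-preservedByDisjoint∨ : ¬ PreservedByDisjoint∨ Nand
Nand-not-preservedByDisjoint∨ pres
  with pres (true ∷ false ∷ []) (false ∷ true ∷ []) (λ { zero → refl ; (suc zero) → refl }) refl refl
... | ()

theorem22 : ((n : ℕ) (R : BRel n) → UppDefinable Γw R → InIE₀ R)
    × (Σ ℕ λ n → Σ (BRel n) λ R → InIE₀ R × ¬ UppDefinable Γw R)
theorem22 =
    (λ _ _ → uppDefinable-InIE₀)
  , 2 , Nand , (Nand-∧ , refl)
  , Nand-not-preservedByDisjoint∨ ∘ uppDefinable-preservedByDisjoint∨ Γw-∧ Γw-false Γw-disjoint-∨
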